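{- For all $n\geq 1$, the $(n-1)$-dimensional permutahedron has a facet-Hamiltonian path from the permutation $1,2,\ldots,n$ to the permutation $n,1,2,\ldots,n-1$.
   Context: Combinatorially, the $(n-1)$-dimensional permutahedron has vertices the permutations of $[n]$ written as words $\pi(1),\pi(2),\ldots,\pi(n)$; two permutations are adjacent iff they differ by swapping two entries in consecutive positions; the facets are indexed by the nonempty proper subsets $S\subsetneq[n]$, and the permutation $\pi$ lies on the facet $S$ iff $S=\{\pi(1),\ldots,\pi(|S|)\}$ (i.e., $S$ is a prefix set of $\pi$). A path $P$ in this graph is facet-Hamiltonian if for every facet $f$, the set of vertices and edges of $P$ lying in $f$ is nonempty and connected. -}

module Defs where

open import Data.Nat using (ℕ; zero; suc; _<_)
open import Data.Fin using (Fin; zero; suc; toℕ; inject₁; fromℕ)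
open import Data.Fin.Subset using (Subset; ∣_∣) renaming (_∈_ to _∈ₛ_)
open import Data.Vec using (Vec; lookup; _[_]≔_; allFin; _∷_; map)
open import Data.Product using (Σ; ∃; _×_; _,_; Σ-syntax; ∃-syntax)
open import Function.Bundles using (_⇔_)
open import Function.Definitions using (Injective)
open import Relation.Binary.PropositionalEquality using (_≡_)
open import Relation.Binary.Construct.Closure.Equivalence using (EqClosure)

-- A word of length n over [n] = Fin n (0-indexed: value k stands for k+1,
-- position i stands for position i+1).
Word : ℕ → Set
Word n = Vec (Fin n) n

IsPerm : ∀ {n} → Word n → Set
IsPerm {n} w = Injective _≡_ _≡_ (lookup w)

Adjacent : ∀ {n} → Word n → Word n → Set
Adjacent {n} w w′ =
  Σ[ i ∈ Fin n ] Σ[ j ∈ Fin n ]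
    (toℕ j ≡ suc (toℕ i) ×
     w′ ≡ ((w [ i ]≔ lookup w j) [ j ]≔ lookup w i))

IsFacet : ∀ {n} → Subset n → Set
IsFacet {n} S = 0 < ∣ S ∣ × ∣ S ∣ < n

OnFacet : ∀ {n} → Subset n → Word n → Set
OnFacet {n} S π =
  ∀ (x : Fin n) → (x ∈ₛ S) ⇔ (∃[ i ] (toℕ i < ∣ S ∣ × lookup π i ≡ x))

record IsPath {n k : ℕ} (p : Fin (suc k) → Word n) : Set where
  field
    perms    : ∀ i → IsPerm (p i)
    distinct : Injective _≡_ _≡_ p
    steps    : ∀ (i : Fin k) → Adjacent (p (inject₁ i)) (p (suc i))

-- Edges of the path (between positions i and i+1) that lie in facet S:
-- an edge lies in a face iff both its endpoints do.
EdgeIn : ∀ {n k} → Subset n → (Fin (suc k) → Word n) →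
         Fin (suc k) → Fin (suc k) → Set
EdgeIn {k = k} S p a b =
  Σ[ i ∈ Fin k ] (a ≡ inject₁ i × b ≡ suc i × OnFacet S (p a) × OnFacet S (p b))

FacetNonemptyConnected : ∀ {n k} → Subset n → (Fin (suc k) → Word n) → Set
FacetNonemptyConnected S p =
  (∃[ a ] OnFacet S (p a)) ×
  (∀ a b → OnFacet S (p a) → OnFacet S (p b) → EqClosure (EdgeIn S p) a b)

FacetHamiltonian : ∀ {n k} → (Fin (suc k) → Word n) → Set
FacetHamiltonian {n} p = ∀ (S : Subset n) → IsFacet S → FacetNonemptyConnected S p

idWord : ∀ m → Word (suc m)
idWord m = allFin (suc m)

rotWord : ∀ m → Word (suc m)
rotWord m = fromℕ m ∷ map inject₁ (allFin m)

{-# OPTIONS --safe #-}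
module Submission where

-- From the path 1 2 … n ⇝ n 1 … n-1 on n letters, the path on n + 1 letters appends n + 1 to
-- every vertex, then slides n + 1 leftwards through n 1 … n-1 until it stands in front, and
-- finally runs through the old path backwards with n + 1 in front, ending at n+1 1 … n.
-- The induction proves more: for every predicate P on letters and every length s, the vertices
-- whose first s letters are exactly the P-letters form one contiguous block of the path. If
-- n + 1 is not a P-letter, a qualifying vertex must have n + 1 outside its first s letters, so the
-- block is the old block in the first part, continued into the start of the slide exactly when
-- the last vertex of the first part belongs to it. If n + 1 is a P-letter the picture is mirrored:
-- the end of the slide followed by the old block for length s - 1 in the backward part.
-- A contiguous block is connected through the path edges inside it, and every facet is visited
-- because each old vertex reappears both with n + 1 at the end and with n + 1 in front.

open import Data.Bool using (true; false)
open import Data.Empty using (⊥-elim)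
open import Data.Fin as Fin using (Fin; zero; suc; toℕ; inject₁; fromℕ; punchIn; punchOut; _≟_)
open import Data.Fin.Properties
  using (toℕ-fromℕ; toℕ-inject₁; toℕ<n; inject₁-injective; fromℕ≢inject₁; punchIn-punchOut;
         all?; any?)
open import Data.Fin.Subset using (Subset; ∣_∣) renaming (_∈_ to _∈ₛ_)
open import Data.Fin.Subset.Properties using (_∈?_; ∣p∣≤n)
open import Data.List using (List; []; _∷_; _++_; _∷ʳ_; map; reverse; length; lookup)
open import Data.List.Properties using (map-++; ++-assoc; unfold-reverse; reverse-++)
open import Data.List.Membership.Propositional using (_∈_; _∉_)
open import Data.List.Membership.Propositional.Properties using (∈-map⁻; ∈-++⁻; ∈-lookup)
open import Data.List.Relation.Unary.All as All using (All; []; _∷_)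
import Data.List.Relation.Unary.All.Properties as All
open import Data.List.Relation.Unary.Any as Any using (Any; here)
import Data.List.Relation.Unary.Any.Properties as Any
open import Data.List.Relation.Unary.AllPairs using ([]; _∷_)
open import Data.List.Relation.Unary.Unique.Propositional using (Unique)
import Data.List.Relation.Unary.Unique.Propositional.Properties as Unique
open import Data.List.Relation.Binary.Disjoint.Propositional using (Disjoint)
open import Data.List.Relation.Binary.Permutation.Propositional using (↭-sym; ↭⇒↭ₛ)
open import Data.List.Relation.Binary.Permutation.Propositional.Properties using (All-resp-↭; ↭-reverse)
import Data.List.Relation.Binary.Permutation.Setoid.Properties as PermutationSetoid
open import Data.Nat using (ℕ; zero; suc; _≤_; _<_; z≤n; s≤s; _≤?_; _<?_)
open import Data.Nat.Properties
  using (≤-refl; ≤-pred; ≰⇒>; <⇒≱; <-≤-trans; ≤-<-trans; m≤n⇒m≤1+n; 1+n≰n)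
open import Data.Product using (Σ-syntax; ∃-syntax; _×_; _,_; proj₁; proj₂; map₂)
open import Data.Sum using (_⊎_; inj₁; inj₂; [_,_])
open import Data.Sum.Function.Propositional using (_⊎-⇔_)
open import Data.Vec as Vec using (Vec; []; _∷_; insertAt; tabulate; _[_]≔_; initLast; here; there)
open import Data.Vec.Properties
  using (insertAt-lookup; insertAt-punchIn; lookup-map; removeAt-insertAt; tabulate-∘; ∷-injective)
open import Function.Base using (_∘_; const; id)
open import Function.Bundles using (_⇔_; mk⇔; Equivalence)
import Function.Properties.Equivalence as ⇔
open import Relation.Binary.Construct.Closure.Equivalence as EqClosure using (EqClosure)
open import Relation.Binary.Construct.Closure.ReflexiveTransitive using (ε; _◅_)
open import Relation.Binary.Construct.Closure.Symmetric using (fwd)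
open import Relation.Binary.Definitions using (Symmetric)
open import Relation.Binary.PropositionalEquality as ≡
  using (_≡_; _≢_; refl; sym; trans; cong; cong₂; subst; module ≡-Reasoning)
open import Relation.Nullary using (¬_; Dec; yes; no)
open import Relation.Nullary.Decidable using (map′; ¬?; _×-dec_; _→-dec_)
open import Relation.Unary using (Decidable)

open import Defs

open Equivalence using (to; from)

-- Walk R x y ys: an R-walk from x to y whose vertices after x are ys.
module _ {A : Set} (R : A → A → Set) where

  data Walk : A → A → List A → Set where
    []  : ∀ {x} → Walk x x []
    _∷_ : ∀ {x y z ys} → R x y → Walk y z ys → Walk x z (y ∷ ys)

reverseTail : ∀ {A : Set} → A → List A → List A
reverseTail x []       = []
reverseTail x (y ∷ ys) = reverseTail y ys ∷ʳ x

module _ {A : Set} {R : A → A → Set} where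

  infixr 5 _++ʷ_
  _++ʷ_ : ∀ {x y z xs ys} → Walk R x y xs → Walk R y z ys → Walk R x z (xs ++ ys)
  []      ++ʷ w = w
  (r ∷ v) ++ʷ w = r ∷ (v ++ʷ w)

  reverseʷ : Symmetric R → ∀ {x y ys} → Walk R x y ys → Walk R y x (reverseTail x ys)
  reverseʷ R-sym []      = []
  reverseʷ R-sym (r ∷ w) = reverseʷ R-sym w ++ʷ (R-sym r ∷ [])

  reverse-vertices : ∀ {x y ys} → Walk R x y ys → reverse (x ∷ ys) ≡ y ∷ reverseTail x ys
  reverse-vertices []                              = refl
  reverse-vertices {x} (_∷_ {y = y} {ys = ys} _ w) = begin
    reverse (x ∷ y ∷ ys)  ≡⟨ unfold-reverse x (y ∷ ys) ⟩
    reverse (y ∷ ys) ∷ʳ x ≡⟨ cong (_∷ʳ x) (reverse-vertices w) ⟩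
    _ ∷ reverseTail y ys ∷ʳ x ∎
    where open ≡-Reasoning

  lookup-last : ∀ {x y ys} → Walk R x y ys → lookup (x ∷ ys) (fromℕ (length ys)) ≡ y
  lookup-last []      = refl
  lookup-last (_ ∷ w) = lookup-last w

  lookup-steps : ∀ {x y ys} → Walk R x y ys →
                 ∀ i → R (lookup (x ∷ ys) (inject₁ i)) (lookup (x ∷ ys) (suc i))
  lookup-steps (r ∷ w) zero    = r
  lookup-steps (r ∷ w) (suc i) = lookup-steps w i

  All-last : ∀ {P : A → Set} {x y ys} → Walk R x y ys → All P (x ∷ ys) → P y
  All-last []      (px ∷ []) = px
  All-last (_ ∷ w) (_ ∷ ps)  = All-last w ps

walk-map : ∀ {A B : Set} {R : A → A → Set} {S : B → B → Set} (f : A → B) →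
           (∀ {a b} → R a b → S (f a) (f b)) →
           ∀ {x y ys} → Walk R x y ys → Walk S (f x) (f y) (map f ys)
walk-map f f-hom []      = []
walk-map f f-hom (r ∷ w) = f-hom r ∷ walk-map f f-hom w

-- Contiguous blocks in lists

-- The phases record whether the block of P-elements has not started, is running, or is over,
-- so Convex P xs says that the P-elements of xs are contiguous.
data Phase : Set where
  before inside after : Phase

module _ {A : Set} (P : A → Set) where

  data Run : Phase → List A → Phase → Set where
    []    : ∀ {φ} → Run φ [] φ
    skip  : ∀ {x xs ψ} → ¬ P x → Run before xs ψ → Run before (x ∷ xs) ψ
    enter : ∀ {x xs ψ} → P x → Run inside xs ψ → Run before (x ∷ xs) ψ
    stay  : ∀ {x xs ψ} → P x → Run inside xs ψ → Run inside (x ∷ xs) ψ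
    leave : ∀ {x xs ψ} → ¬ P x → Run after xs ψ → Run inside (x ∷ xs) ψ
    pass  : ∀ {x xs ψ} → ¬ P x → Run after xs ψ → Run after (x ∷ xs) ψ

  Convex : List A → Set
  Convex xs = ∃[ ψ ] Run before xs ψ

  -- Runs cannot be reversed step by step, so reversal goes through the three-segment form.
  data Segmented : List A → Set where
    segments : ∀ {as bs cs} → All (¬_ ∘ P) as → All P bs → All (¬_ ∘ P) cs →
               Segmented (as ++ bs ++ cs)

  data Block : List A → Set where
    block : ∀ {bs cs} → All P bs → All (¬_ ∘ P) cs → Block (bs ++ cs)

Interval : ∀ {n} → (Fin n → Set) → Set
Interval U = ∀ {a b c} → a Fin.≤ b → b Fin.≤ c → U a → U c → U b

All-reverse : ∀ {A : Set} {Q : A → Set} {xs} → All Q xs → All Q (reverse xs)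
All-reverse {xs = xs} = All-resp-↭ (↭-sym (↭-reverse xs))

module _ {A : Set} {P : A → Set} where

  infixr 5 _++ʳ_
  _++ʳ_ : ∀ {φ ψ χ xs ys} → Run P φ xs ψ → Run P ψ ys χ → Run P φ (xs ++ ys) χ
  []         ++ʳ r′ = r′
  skip  ¬p r ++ʳ r′ = skip ¬p (r ++ʳ r′)
  enter p r  ++ʳ r′ = enter p (r ++ʳ r′)
  stay  p r  ++ʳ r′ = stay p (r ++ʳ r′)
  leave ¬p r ++ʳ r′ = leave ¬p (r ++ʳ r′)
  pass  ¬p r ++ʳ r′ = pass ¬p (r ++ʳ r′)

  run-skip : ∀ {xs} → All (¬_ ∘ P) xs → Run P before xs before
  run-skip []         = []
  run-skip (¬p ∷ ¬ps) = skip ¬p (run-skip ¬ps)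

  run-stay : ∀ {xs} → All P xs → Run P inside xs inside
  run-stay []       = []
  run-stay (p ∷ ps) = stay p (run-stay ps)

  run-off : ∀ {xs} → All (¬_ ∘ P) xs → ∀ φ → ∃[ ψ ] Run P φ xs ψ
  run-off []         φ      = φ , []
  run-off (¬p ∷ ¬ps) before = let ψ , r = run-off ¬ps before in ψ , skip ¬p r
  run-off (¬p ∷ ¬ps) inside = let ψ , r = run-off ¬ps after in ψ , leave ¬p r
  run-off (¬p ∷ ¬ps) after  = let ψ , r = run-off ¬ps after in ψ , pass ¬p r

  All⇒Convex : ∀ {xs} → All P xs → Convex P xs
  All⇒Convex []       = before , []
  All⇒Convex (p ∷ ps) = inside , enter p (run-stay ps)

  convex-const : ∀ {C : Set} {xs} → Dec C → All (λ x → P x ⇔ C) xs → Convex P xs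
  convex-const (yes c) P⇔C = All⇒Convex (All.map (λ e → from e c) P⇔C)
  convex-const (no ¬c) P⇔C = run-off (All.map (λ e → ¬c ∘ to e) P⇔C) before

  run-after-head : ∀ {φ ψ x xs} → Run P φ (x ∷ xs) ψ → P x → Run P inside xs ψ
  run-after-head (skip ¬p r)  p = ⊥-elim (¬p p)
  run-after-head (enter _ r)  p = r
  run-after-head (stay _ r)   p = r
  run-after-head (leave ¬p r) p = ⊥-elim (¬p p)
  run-after-head (pass ¬p r)  p = ⊥-elim (¬p p)

  run-tail : ∀ {φ ψ x xs} → Run P φ (x ∷ xs) ψ → ∃[ φ′ ] Run P φ′ xs ψ
  run-tail (skip _ r)  = _ , r
  run-tail (enter _ r) = _ , r
  run-tail (stay _ r)  = _ , r
  run-tail (leave _ r) = _ , r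
  run-tail (pass _ r)  = _ , r

  run-ends-inside : ∀ {R : A → A → Set} {φ ψ x y ys} →
                    Walk R x y ys → Run P φ (x ∷ ys) ψ → P y → ψ ≡ inside
  run-ends-inside []      r p with run-after-head r p
  ... | [] = refl
  run-ends-inside (_ ∷ w) r p = run-ends-inside w (proj₂ (run-tail r)) p

  prepend-block : ∀ {ψ xs y zs} → All P xs → Run P before (y ∷ zs) ψ → P y →
                  Run P before (xs ++ y ∷ zs) ψ
  prepend-block []       r py = r
  prepend-block (p ∷ ps) r py = enter p (run-stay ps ++ʳ stay py (run-after-head r py))

  run-after-off : ∀ {xs ψ} → Run P after xs ψ → All (¬_ ∘ P) xs
  run-after-off []          = []
  run-after-off (pass ¬p r) = ¬p ∷ run-after-off r

  run-inside-downward-closed : ∀ {xs ψ} → Run P inside xs ψ →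
                               ∀ {b c} → b Fin.≤ c → P (lookup xs c) → P (lookup xs b)
  run-inside-downward-closed (stay p r)   {zero}          _         _  = p
  run-inside-downward-closed (stay p r)   {suc b} {suc c} (s≤s b≤c) pc = run-inside-downward-closed r b≤c pc
  run-inside-downward-closed (leave ¬p r) {zero}  {zero}  _         pc = ⊥-elim (¬p pc)
  run-inside-downward-closed (leave ¬p r) {_}     {suc c} _         pc =
    ⊥-elim (All.lookup (run-after-off r) (∈-lookup c) pc)

  run-interval : ∀ {xs ψ} → Run P before xs ψ → Interval (P ∘ lookup xs)
  run-interval (skip ¬p r) {zero}                  _         _         pa pc = ⊥-elim (¬p pa)
  run-interval (skip ¬p r) {suc a} {suc b} {suc c} (s≤s a≤b) (s≤s b≤c) pa pc = run-interval r a≤b b≤c pa pc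
  run-interval (enter p r) {b = zero}              _         _         pa pc = p
  run-interval (enter p r) {b = suc b} {suc c}     _         (s≤s b≤c) pa pc =
    run-inside-downward-closed r b≤c pc

  run-inside-block : ∀ {xs ψ} → Run P inside xs ψ → Block P xs
  run-inside-block []           = block [] []
  run-inside-block (stay p r)   with run-inside-block r
  ... | block ps ¬ps = block (p ∷ ps) ¬ps
  run-inside-block (leave ¬p r) = block [] (¬p ∷ run-after-off r)

  run-segmented : ∀ {xs ψ} → Run P before xs ψ → Segmented P xs
  run-segmented []          = segments [] [] []
  run-segmented (skip ¬p r) with run-segmented r
  ... | segments ¬as bs ¬cs = segments (¬p ∷ ¬as) bs ¬cs
  run-segmented (enter p r) with run-inside-block r
  ... | block ps ¬ps = segments [] (p ∷ ps) ¬ps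

  segmented-convex : ∀ {xs} → Segmented P xs → Convex P xs
  segmented-convex (segments ¬as bs ¬cs) =
    let φ , r = All⇒Convex bs; ψ , r′ = run-off ¬cs φ in ψ , run-skip ¬as ++ʳ r ++ʳ r′

  segmented-reverse : ∀ {xs} → Segmented P xs → Segmented P (reverse xs)
  segmented-reverse (segments {as} {bs} {cs} ¬as bs′ ¬cs) =
    subst (Segmented P) (sym reverse-segments) (segments (All-reverse ¬cs) (All-reverse bs′) (All-reverse ¬as))
    where
    open ≡-Reasoning
    reverse-segments : reverse (as ++ bs ++ cs) ≡ reverse cs ++ reverse bs ++ reverse as
    reverse-segments = begin
      reverse (as ++ bs ++ cs)                 ≡⟨ reverse-++ as (bs ++ cs) ⟩
      reverse (bs ++ cs) ++ reverse as         ≡⟨ cong (_++ reverse as) (reverse-++ bs cs) ⟩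
      (reverse cs ++ reverse bs) ++ reverse as ≡⟨ ++-assoc (reverse cs) (reverse bs) (reverse as) ⟩
      reverse cs ++ reverse bs ++ reverse as   ∎

  convex-reverse : ∀ {xs} → Convex P xs → Convex P (reverse xs)
  convex-reverse (_ , r) = segmented-convex (segmented-reverse (run-segmented r))

run-map : ∀ {A B : Set} {P : B → Set} {Q : A → Set} (f : A → B) → (∀ a → P (f a) ⇔ Q a) →
          ∀ {φ ψ xs} → Run Q φ xs ψ → Run P φ (map f xs) ψ
run-map f P⇔Q []           = []
run-map f P⇔Q (skip ¬q r)  = skip (¬q ∘ to (P⇔Q _)) (run-map f P⇔Q r)
run-map f P⇔Q (enter q r)  = enter (from (P⇔Q _) q) (run-map f P⇔Q r)
run-map f P⇔Q (stay q r)   = stay (from (P⇔Q _) q) (run-map f P⇔Q r)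
run-map f P⇔Q (leave ¬q r) = leave (¬q ∘ to (P⇔Q _)) (run-map f P⇔Q r)
run-map f P⇔Q (pass ¬q r)  = pass (¬q ∘ to (P⇔Q _)) (run-map f P⇔Q r)

-- EdgeIn S p is Link (OnFacet S ∘ p).
Link : ∀ {k} → (Fin (suc k) → Set) → Fin (suc k) → Fin (suc k) → Set
Link {k} U a b = Σ[ i ∈ Fin k ] (a ≡ inject₁ i × b ≡ suc i × U a × U b)

interval-connected : ∀ {k} {U : Fin (suc k) → Set} → Interval U →
                     ∀ a b → U a → U b → EqClosure (Link U) a b
interval-connected {zero}      U-int zero zero _ _ = ε
interval-connected {suc k} {U} U-int = connect
  where
  connect-suc : ∀ a b → U (suc a) → U (suc b) → EqClosure (Link U) (suc a) (suc b)
  connect-suc a b ua ub = EqClosure.gmap suc (λ { (i , refl , refl , ua , ub) → suc i , refl , refl , ua , ub })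
    (interval-connected (λ a≤b b≤c → U-int (s≤s a≤b) (s≤s b≤c)) a b ua ub)

  connect-zero : ∀ b → U zero → U (suc b) → EqClosure (Link U) zero (suc b)
  connect-zero b u0 ub = fwd (zero , refl , refl , u0 , u1) ◅ connect-suc zero b u1 ub
    where u1 = U-int z≤n (s≤s z≤n) u0 ub

  connect : ∀ a b → U a → U b → EqClosure (Link U) a b
  connect zero    zero    _  _  = ε
  connect zero    (suc b) u0 ub = connect-zero b u0 ub
  connect (suc a) zero    ua u0 = EqClosure.symmetric (Link U) (connect-zero a u0 ua)
  connect (suc a) (suc b) ua ub = connect-suc a b ua ub

data Swapped {A : Set} : ∀ {n} → Vec A n → Vec A n → Set where
  swap  : ∀ {n x y} {xs : Vec A n} → Swapped (x ∷ y ∷ xs) (y ∷ x ∷ xs)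
  there : ∀ {n x} {xs ys : Vec A n} → Swapped xs ys → Swapped (x ∷ xs) (x ∷ ys)

module _ {A : Set} where

  Swapped-sym : ∀ {n} {xs ys : Vec A n} → Swapped xs ys → Swapped ys xs
  Swapped-sym swap      = swap
  Swapped-sym (there s) = there (Swapped-sym s)

  Swapped-insertAt-fromℕ : ∀ {n} {xs ys : Vec A n} {v} → Swapped xs ys →
                           Swapped (insertAt xs (fromℕ n) v) (insertAt ys (fromℕ n) v)
  Swapped-insertAt-fromℕ swap      = swap
  Swapped-insertAt-fromℕ (there s) = there (Swapped-insertAt-fromℕ s)

  insertAt-slide : ∀ {n} (xs : Vec A n) i v → Swapped (insertAt xs (suc i) v) (insertAt xs (inject₁ i) v)
  insertAt-slide (x ∷ xs) zero    v = swap
  insertAt-slide (x ∷ xs) (suc i) v = there (insertAt-slide xs i v)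

  Swapped-transposition : ∀ {n} {xs ys : Vec A n} → Swapped xs ys →
    Σ[ i ∈ Fin n ] Σ[ j ∈ Fin n ]
      (toℕ j ≡ suc (toℕ i) × ys ≡ (xs [ i ]≔ Vec.lookup xs j) [ j ]≔ Vec.lookup xs i)
  Swapped-transposition swap      = zero , suc zero , refl , refl
  Swapped-transposition (there s) =
    let i , j , j≡1+i , ys≡ = Swapped-transposition s in suc i , suc j , cong suc j≡1+i , cong (_ ∷_) ys≡

Swapped-map : ∀ {A B : Set} (f : A → B) {n} {xs ys : Vec A n} →
              Swapped xs ys → Swapped (Vec.map f xs) (Vec.map f ys)
Swapped-map f swap      = swap
Swapped-map f (there s) = there (Swapped-map f s)

module _ {A : Set} where

  Occurs : ∀ {n} → ℕ → Vec A n → A → Set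
  Occurs s xs x = ∃[ i ] (toℕ i < s × Vec.lookup xs i ≡ x)

  occurs-zero : ∀ {n} (xs : Vec A n) {x} → ¬ Occurs 0 xs x
  occurs-zero xs (_ , () , _)

  occurs-∷ : ∀ {n s y} {xs : Vec A n} {x} → Occurs (suc s) (y ∷ xs) x ⇔ (y ≡ x ⊎ Occurs s xs x)
  occurs-∷ = mk⇔ (λ { (zero , _ , e) → inj₁ e ; (suc i , s≤s i<s , e) → inj₂ (i , i<s , e) })
                 [ (λ e → zero , s≤s z≤n , e) , (λ { (i , i<s , e) → suc i , s≤s i<s , e }) ]

  occurs-insertAt-≥ : ∀ {n} s (xs : Vec A n) j {v x} → s ≤ toℕ j →
                      Occurs s (insertAt xs j v) x ⇔ Occurs s xs x
  occurs-insertAt-≥ zero    xs       j       _         = mk⇔ (λ { (_ , () , _) }) (λ { (_ , () , _) })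
  occurs-insertAt-≥ (suc s) (y ∷ xs) (suc j) (s≤s s≤j) =
    ⇔.trans occurs-∷ (⇔.trans (⇔.refl ⊎-⇔ occurs-insertAt-≥ s xs j s≤j) (⇔.sym occurs-∷))

  occurs-insertAt-< : ∀ {n} s (xs : Vec A n) j {v x} → toℕ j ≤ s → v ≢ x →
                      Occurs (suc s) (insertAt xs j v) x ⇔ Occurs s xs x
  occurs-insertAt-< s       xs       zero    _         v≢x =
    ⇔.trans occurs-∷ (mk⇔ [ ⊥-elim ∘ v≢x , id ] inj₂)
  occurs-insertAt-< (suc s) (y ∷ xs) (suc j) (s≤s j≤s) v≢x =
    ⇔.trans occurs-∷ (⇔.trans (⇔.refl ⊎-⇔ occurs-insertAt-< s xs j j≤s v≢x) (⇔.sym occurs-∷))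

  occurs-insertAt-self : ∀ {n} s (xs : Vec A n) j {v} → (∀ i → Vec.lookup xs i ≢ v) →
                         Occurs s (insertAt xs j v) v ⇔ toℕ j < s
  occurs-insertAt-self zero    xs       j       v∉xs = mk⇔ (λ { (_ , () , _) }) (λ ())
  occurs-insertAt-self (suc s) xs       zero    v∉xs =
    mk⇔ (const (s≤s z≤n)) (const (zero , s≤s z≤n , refl))
  occurs-insertAt-self (suc s) (y ∷ xs) (suc j) v∉xs =
    ⇔.trans occurs-∷ (⇔.trans (mk⇔ [ ⊥-elim ∘ v∉xs zero , id ] inj₂)
      (⇔.trans (occurs-insertAt-self s xs j (v∉xs ∘ suc)) (mk⇔ s≤s ≤-pred)))

occurs-map : ∀ {A B : Set} {f : A → B} → (∀ {a b} → f a ≡ f b → a ≡ b) →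
             ∀ {n} s (xs : Vec A n) y → Occurs s (Vec.map f xs) (f y) ⇔ Occurs s xs y
occurs-map {f = f} f-inj s xs y =
  mk⇔ (λ { (i , i<s , e) → i , i<s , f-inj (trans (sym (lookup-map i f xs)) e) })
      (λ { (i , i<s , e) → i , i<s , trans (lookup-map i f xs) (cong f e) })

Onto : ∀ {n} → Word n → Set
Onto {n} π = ∀ (x : Fin n) → ∃[ i ] Vec.lookup π i ≡ x

-- OnFacet S is Prefix (_∈ₛ S) ∣ S ∣; the induction needs arbitrary predicates and lengths.
Prefix : ∀ {n} → (Fin n → Set) → ℕ → Word n → Set
Prefix P s π = ∀ x → P x ⇔ Occurs s π x

⇔-dec : ∀ {A B : Set} → Dec A → Dec B → Dec (A ⇔ B)
⇔-dec A? B? = map′ (λ (f , g) → mk⇔ f g) (λ e → to e , from e) ((A? →-dec B?) ×-dec (B? →-dec A?))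

prefix? : ∀ {n} {P : Fin n → Set} → Decidable P → ∀ s π → Dec (Prefix P s π)
prefix? P? s π = all? λ x → ⇔-dec (P? x) (any? λ i → (toℕ i <? s) ×-dec (Vec.lookup π i ≟ x))

prefix-cong : ∀ {n} {P Q : Fin n → Set} s π → (∀ x → P x ⇔ Q x) → Prefix P s π → Prefix Q s π
prefix-cong s π P⇔Q H x = ⇔.trans (⇔.sym (P⇔Q x)) (H x)

prefix-zero : ∀ {n} {P : Fin n → Set} π → Prefix P 0 π ⇔ (∀ x → ¬ P x)
prefix-zero π = mk⇔ (λ H x p → occurs-zero π (to (H x) p))
                    (λ ¬P x → mk⇔ (⊥-elim ∘ ¬P x) (⊥-elim ∘ occurs-zero π))

prefix-full : ∀ {n} {P : Fin n → Set} {s} π → n ≤ s → Onto π → Prefix P s π ⇔ (∀ x → P x)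
prefix-full {s = s} π n≤s π-onto =
  mk⇔ (λ H x → from (H x) (occurs x)) (λ P x → mk⇔ (const (occurs x)) (const (P x)))
  where
  occurs : ∀ x → Occurs s π x
  occurs x = let i , e = π-onto x in i , <-≤-trans (toℕ<n i) n≤s , e

elim-fromℕ-inject₁ : ∀ {N} {F : Fin (suc N) → Set} →
                     F (fromℕ N) → (∀ y → F (inject₁ y)) → ∀ x → F x
elim-fromℕ-inject₁ {zero}      F-top F-inj zero    = F-top
elim-fromℕ-inject₁ {suc N}     F-top F-inj zero    = F-inj zero
elim-fromℕ-inject₁ {suc N} {F} F-top F-inj (suc x) =
  elim-fromℕ-inject₁ {F = F ∘ suc} F-top (F-inj ∘ suc) x

punchIn-view : ∀ {N} (j k : Fin (suc N)) → j ≡ k ⊎ ∃[ i ] punchIn j i ≡ k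
punchIn-view j k with j ≟ k
... | yes j≡k = inj₁ j≡k
... | no  j≢k = inj₂ (punchOut j≢k , punchIn-punchOut j≢k)

insertMax : ∀ {N} → Fin (suc N) → Word N → Word (suc N)
insertMax {N} j w = insertAt (Vec.map inject₁ w) j (fromℕ N)

module _ {N} (j : Fin (suc N)) (w : Word N) where

  lookup-insertMax : Vec.lookup (insertMax j w) j ≡ fromℕ N
  lookup-insertMax = insertAt-lookup (Vec.map inject₁ w) j (fromℕ N)

  lookup-insertMax-punchIn : ∀ i → Vec.lookup (insertMax j w) (punchIn j i) ≡ inject₁ (Vec.lookup w i)
  lookup-insertMax-punchIn i =
    trans (insertAt-punchIn (Vec.map inject₁ w) j (fromℕ N) i) (lookup-map i inject₁ w)

  occurs-fromℕ : ∀ s → Occurs s (insertMax j w) (fromℕ N) ⇔ toℕ j < s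
  occurs-fromℕ s = occurs-insertAt-self s _ j
    λ i e → fromℕ≢inject₁ (sym (trans (sym (lookup-map i inject₁ w)) e))

  prefix-insertMax-≥ : ∀ (P : Fin (suc N) → Set) s → s ≤ toℕ j →
                       Prefix P s (insertMax j w) ⇔ (¬ P (fromℕ N) × Prefix (P ∘ inject₁) s w)
  prefix-insertMax-≥ P s s≤j =
    mk⇔ (λ H → (λ p → fromℕ-absent (to (H _) p)) , λ y → ⇔.trans (H (inject₁ y)) (occurs-inject₁ y))
        (λ (¬p , H) → elim-fromℕ-inject₁ (mk⇔ (⊥-elim ∘ ¬p) (⊥-elim ∘ fromℕ-absent))
                                          λ y → ⇔.trans (H y) (⇔.sym (occurs-inject₁ y)))
    where
    fromℕ-absent : ¬ Occurs s (insertMax j w) (fromℕ N)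
    fromℕ-absent o = <⇒≱ (to (occurs-fromℕ s) o) s≤j
    occurs-inject₁ : ∀ y → Occurs s (insertMax j w) (inject₁ y) ⇔ Occurs s w y
    occurs-inject₁ y = ⇔.trans (occurs-insertAt-≥ s _ j s≤j) (occurs-map inject₁-injective s w y)

  prefix-insertMax-< : ∀ (P : Fin (suc N) → Set) s → toℕ j ≤ s →
                       Prefix P (suc s) (insertMax j w) ⇔ (P (fromℕ N) × Prefix (P ∘ inject₁) s w)
  prefix-insertMax-< P s j≤s =
    mk⇔ (λ H → from (H _) fromℕ-present , λ y → ⇔.trans (H (inject₁ y)) (occurs-inject₁ y))
        (λ (p , H) → elim-fromℕ-inject₁ (mk⇔ (const fromℕ-present) (const p))
                                         λ y → ⇔.trans (H y) (⇔.sym (occurs-inject₁ y)))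
    where
    fromℕ-present : Occurs (suc s) (insertMax j w) (fromℕ N)
    fromℕ-present = from (occurs-fromℕ (suc s)) (s≤s j≤s)
    occurs-inject₁ : ∀ y → Occurs (suc s) (insertMax j w) (inject₁ y) ⇔ Occurs s w y
    occurs-inject₁ y =
      ⇔.trans (occurs-insertAt-< s _ j j≤s fromℕ≢inject₁) (occurs-map inject₁-injective s w y)

  insertMax-position : ∀ {k} → Vec.lookup (insertMax j w) k ≡ fromℕ N → j ≡ k
  insertMax-position {k} e with punchIn-view j k
  ... | inj₁ j≡k        = j≡k
  ... | inj₂ (i , refl) = ⊥-elim (fromℕ≢inject₁ (trans (sym e) (lookup-insertMax-punchIn i)))

  insertMax-perm : IsPerm w → IsPerm (insertMax j w)
  insertMax-perm w-perm {a} {b} e with punchIn-view j a | punchIn-view j b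
  ... | inj₁ refl       | _                = insertMax-position (trans (sym e) lookup-insertMax)
  ... | inj₂ (i , refl) | inj₁ refl        = sym (insertMax-position (trans e lookup-insertMax))
  ... | inj₂ (i , refl) | inj₂ (i′ , refl) = cong (punchIn j) (w-perm (inject₁-injective
    (trans (sym (lookup-insertMax-punchIn i)) (trans e (lookup-insertMax-punchIn i′)))))

  insertMax-onto : Onto w → Onto (insertMax j w)
  insertMax-onto w-onto = elim-fromℕ-inject₁ (j , lookup-insertMax)
    λ y → let i , e = w-onto y in punchIn j i , trans (lookup-insertMax-punchIn i) (cong inject₁ e)

Vec-map-injective : ∀ {A B : Set} {f : A → B} → (∀ {a b} → f a ≡ f b → a ≡ b) →
                    ∀ {n} {xs ys : Vec A n} → Vec.map f xs ≡ Vec.map f ys → xs ≡ ys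
Vec-map-injective f-inj {xs = []}     {[]}     _ = refl
Vec-map-injective f-inj {xs = x ∷ xs} {y ∷ ys} e =
  let x≡y , xs≡ys = ∷-injective e in cong₂ _∷_ (f-inj x≡y) (Vec-map-injective f-inj xs≡ys)

insertMax-injective : ∀ {N} {i j : Fin (suc N)} {a b : Word N} →
                      insertMax i a ≡ insertMax j b → i ≡ j × a ≡ b
insertMax-injective {i = i} {j} {a} {b} e
  with insertMax-position j b (trans (cong (λ v → Vec.lookup v i) (sym e)) (lookup-insertMax i a))
... | refl = refl , Vec-map-injective inject₁-injective (begin
  Vec.map inject₁ a              ≡⟨ removeAt-insertAt (Vec.map inject₁ a) i _ ⟨
  Vec.removeAt (insertMax i a) i ≡⟨ cong (λ v → Vec.removeAt v i) e ⟩
  Vec.removeAt (insertMax i b) i ≡⟨ removeAt-insertAt (Vec.map inject₁ b) i _ ⟩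
  Vec.map inject₁ b              ∎)
  where open ≡-Reasoning

insertMax-injectiveˡ : ∀ {N} (w : Word N) {i j} → insertMax i w ≡ insertMax j w → i ≡ j
insertMax-injectiveˡ w = proj₁ ∘ insertMax-injective

insertMax-injectiveʳ : ∀ {N} (j : Fin (suc N)) {a b} → insertMax j a ≡ insertMax j b → a ≡ b
insertMax-injectiveʳ j = proj₂ ∘ insertMax-injective

insertAt-tabulate-fromℕ : ∀ {A : Set} {n} (g : Fin (suc n) → A) →
                          insertAt (tabulate (g ∘ inject₁)) (fromℕ n) (g (fromℕ n)) ≡ tabulate g
insertAt-tabulate-fromℕ {n = zero}  g = refl
insertAt-tabulate-fromℕ {n = suc n} g = cong (g zero ∷_) (insertAt-tabulate-fromℕ (g ∘ suc))

insertMax-idWord : ∀ m → insertMax (fromℕ (suc m)) (idWord m) ≡ idWord (suc m)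
insertMax-idWord m = begin
  insertAt (Vec.map inject₁ (tabulate id)) (fromℕ (suc m)) (fromℕ (suc m))
    ≡⟨ cong (λ v → insertAt v (fromℕ (suc m)) (fromℕ (suc m))) (tabulate-∘ inject₁ id) ⟨
  insertAt (tabulate inject₁) (fromℕ (suc m)) (fromℕ (suc m))
    ≡⟨ insertAt-tabulate-fromℕ id ⟩
  tabulate id
    ∎
  where open ≡-Reasoning

Swapped-insertMax-fromℕ : ∀ {N} {a b : Word N} → Swapped a b →
                          Swapped (insertMax (fromℕ N) a) (insertMax (fromℕ N) b)
Swapped-insertMax-fromℕ = Swapped-insertAt-fromℕ ∘ Swapped-map inject₁

Swapped-insertMax-zero : ∀ {N} {a b : Word N} → Swapped a b → Swapped (insertMax zero a) (insertMax zero b)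
Swapped-insertMax-zero = there ∘ Swapped-map inject₁

-- The path

data _↘_ {n} : Fin (suc n) → Fin (suc n) → Set where
  down : (i : Fin n) → suc i ↘ inject₁ i

interior : ∀ m → List (Fin (suc (suc m)))
interior zero    = []
interior (suc m) = inject₁ (fromℕ (suc m)) ∷ map inject₁ (interior m)

interior-walk : ∀ m → Walk _↘_ (fromℕ (suc m)) (suc zero) (interior m)
interior-walk zero    = []
interior-walk (suc m) =
  down (fromℕ (suc m)) ∷ walk-map inject₁ (λ { (down i) → down (inject₁ i) }) (interior-walk m)

insertMax-↘ : ∀ {N} (w : Word N) {a b} → a ↘ b → Swapped (insertMax a w) (insertMax b w)
insertMax-↘ w (down i) = insertAt-slide (Vec.map inject₁ w) i _

route : ∀ m → List (Word (suc m))
route zero    = []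
route (suc m) = map (insertMax (fromℕ (suc m))) (route m)
             ++ map (λ j → insertMax j (rotWord m)) (interior m)
             ++ map (insertMax zero) (reverse (idWord m ∷ route m))

vertices : ∀ m → List (Word (suc m))
vertices m = idWord m ∷ route m

vertices-suc : ∀ m → vertices (suc m) ≡ map (insertMax (fromℕ (suc m))) (vertices m)
                                      ++ map (λ j → insertMax j (rotWord m)) (interior m)
                                      ++ map (insertMax zero) (reverse (vertices m))
vertices-suc m = cong (_∷ route (suc m)) (sym (insertMax-idWord m))

walk : ∀ m → Walk Swapped (idWord m) (rotWord m) (route m)
walk zero    = []
walk (suc m) = subst (λ x → Walk Swapped x (rotWord (suc m)) (route (suc m))) (insertMax-idWord m)
  (walk-map _ Swapped-insertMax-fromℕ (walk m)
   ++ʷ walk-map (λ j → insertMax j w) (insertMax-↘ w) (interior-walk m)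
   ++ʷ subst (Walk Swapped _ _) (cong (map (insertMax zero)) (sym (reverse-vertices (walk m))))
         (insertMax-↘ w (down zero) ∷
          walk-map (insertMax zero) Swapped-insertMax-zero (reverseʷ Swapped-sym (walk m))))
  where w = rotWord m

All-vertices : ∀ (R : ∀ {n} → Word n → Set) → R (zero ∷ []) →
               (∀ {N} j {w : Word N} → R w → R (insertMax j w)) → ∀ m → All R (vertices m)
All-vertices R R-base R-insertMax zero    = R-base ∷ []
All-vertices R R-base R-insertMax (suc m) = subst (All R) (sym (vertices-suc m))
  (All.++⁺ (All.map⁺ (All.map (R-insertMax _) R-V))
  (All.++⁺ (All.map⁺ (All.universal (λ j → R-insertMax j (All-last (walk m) R-V)) (interior m)))
           (All.map⁺ (All.map (R-insertMax zero) (All-reverse R-V)))))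
  where R-V = All-vertices R R-base R-insertMax m

vertices-perm : ∀ m → All IsPerm (vertices m)
vertices-perm = All-vertices IsPerm (λ { {zero} {zero} _ → refl }) (λ j → insertMax-perm j _)

vertices-onto : ∀ m → All Onto (vertices m)
vertices-onto = All-vertices Onto (λ { zero → zero , refl }) (λ j → insertMax-onto j _)

All-map-inject₁ : ∀ {n} (Q : ℕ → Set) {js : List (Fin n)} →
                  All (Q ∘ toℕ) js → All (Q ∘ toℕ) (map inject₁ js)
All-map-inject₁ Q = All.map⁺ ∘ All.map (λ {j} → subst Q (sym (toℕ-inject₁ j)))

toℕ-inject₁-fromℕ : ∀ n → toℕ (inject₁ (fromℕ n)) ≡ n
toℕ-inject₁-fromℕ n = trans (toℕ-inject₁ (fromℕ n)) (toℕ-fromℕ n)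

interior-bounds : ∀ m → All (λ j → 0 < toℕ j × toℕ j ≤ m) (interior m)
interior-bounds zero    = []
interior-bounds (suc m) =
  subst (λ k → 0 < k × k ≤ suc m) (sym (toℕ-inject₁-fromℕ (suc m))) (s≤s z≤n , ≤-refl) ∷
  All-map-inject₁ (λ k → 0 < k × k ≤ suc m) (All.map (map₂ m≤n⇒m≤1+n) (interior-bounds m))

fromℕ∉interior : ∀ m → fromℕ (suc m) ∉ interior m
fromℕ∉interior m j∈ =
  1+n≰n (subst (_≤ m) (toℕ-fromℕ (suc m)) (proj₂ (All.lookup (interior-bounds m) j∈)))

zero∉interior : ∀ m → zero ∉ interior m
zero∉interior m j∈ with All.lookup (interior-bounds m) j∈
... | () , _

interior-unique : ∀ m → Unique (interior m)
interior-unique zero    = []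
interior-unique (suc m) = All.tabulate fromℕ-fresh ∷ Unique.map⁺ inject₁-injective (interior-unique m)
  where
  fromℕ-fresh : ∀ {j} → j ∈ map inject₁ (interior m) → inject₁ (fromℕ (suc m)) ≢ j
  fromℕ-fresh j∈ e with ∈-map⁻ inject₁ j∈
  ... | k , k∈ , refl = fromℕ∉interior m (subst (_∈ interior m) (sym (inject₁-injective e)) k∈)

interior-split : ∀ m t → ∃[ hi ] ∃[ lo ]
  (interior m ≡ hi ++ lo × All (λ j → t ≤ toℕ j) hi × All (λ j → toℕ j < t) lo)
interior-split zero    t = [] , [] , refl , [] , []
interior-split (suc m) t with t ≤? suc m | interior-split m t
... | yes t≤ | hi , lo , interior≡ , hi≥ , lo< =
  inject₁ (fromℕ (suc m)) ∷ map inject₁ hi , map inject₁ lo ,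
  cong (_ ∷_) (trans (cong (map inject₁) interior≡) (map-++ inject₁ hi lo)) ,
  subst (t ≤_) (sym (toℕ-inject₁-fromℕ (suc m))) t≤ ∷ All-map-inject₁ (t ≤_) hi≥ ,
  All-map-inject₁ (_< t) lo<
... | no t≰ | _ =
  [] , interior (suc m) , refl , [] , All.map (λ (_ , j≤) → ≤-<-trans j≤ (≰⇒> t≰)) (interior-bounds (suc m))

Unique-reverse : ∀ {A : Set} {xs : List A} → Unique xs → Unique (reverse xs)
Unique-reverse {A} {xs} = PermutationSetoid.Unique-resp-↭ (≡.setoid A) (↭⇒↭ₛ (↭-sym (↭-reverse xs)))

Unique-lookup-injective : ∀ {A : Set} {xs : List A} → Unique xs →
                          ∀ {i j} → lookup xs i ≡ lookup xs j → i ≡ j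
Unique-lookup-injective (x∉ ∷ u) {zero}  {zero}  e = refl
Unique-lookup-injective (x∉ ∷ u) {zero}  {suc j} e = ⊥-elim (All.lookup x∉ (∈-lookup j) e)
Unique-lookup-injective (x∉ ∷ u) {suc i} {zero}  e = ⊥-elim (All.lookup x∉ (∈-lookup i) (sym e))
Unique-lookup-injective (x∉ ∷ u) {suc i} {suc j} e = cong suc (Unique-lookup-injective u e)

vertices-unique : ∀ m → Unique (vertices m)
vertices-unique zero    = [] ∷ []
vertices-unique (suc m) = subst Unique (sym (vertices-suc m))
  (Unique.++⁺ (Unique.map⁺ (insertMax-injectiveʳ (fromℕ (suc m))) U-V)
  (Unique.++⁺ (Unique.map⁺ (insertMax-injectiveˡ (rotWord m)) (interior-unique m))
              (Unique.map⁺ (insertMax-injectiveʳ zero) (Unique-reverse U-V))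
              slide∩back)
  end∩rest)
  where
  U-V   = vertices-unique m
  end   = map (insertMax (fromℕ (suc m))) (vertices m)
  slide = map (λ j → insertMax j (rotWord m)) (interior m)
  back  = map (insertMax zero) (reverse (vertices m))

  slide∩back : Disjoint slide back
  slide∩back (v∈slide , v∈back)
    with ∈-map⁻ (λ j → insertMax j (rotWord m)) v∈slide | ∈-map⁻ (insertMax zero) v∈back
  ... | j , j∈ , refl | b , _ , e =
    zero∉interior m (subst (_∈ interior m) (proj₁ (insertMax-injective {i = j} {b = b} e)) j∈)

  end∩rest : Disjoint end (slide ++ back)
  end∩rest (v∈end , v∈rest)
    with ∈-map⁻ (insertMax (fromℕ (suc m))) {xs = vertices m} v∈end | ∈-++⁻ slide v∈rest
  ... | a , _ , refl | inj₁ v∈slide with ∈-map⁻ (λ j → insertMax j (rotWord m)) v∈slide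
  ...   | j , j∈ , e =
    fromℕ∉interior m (subst (_∈ interior m) (sym (proj₁ (insertMax-injective {j = j} {a = a} e))) j∈)
  end∩rest (v∈end , v∈rest) | a , _ , refl | inj₂ v∈back with ∈-map⁻ (insertMax zero) v∈back
  ...   | b , _ , e with proj₁ (insertMax-injective {j = zero} {a = a} {b} e)
  ...     | ()

-- Facets along the path

∈-∷ʳ-inject₁ : ∀ {n} (T : Subset n) b y → inject₁ y ∈ₛ T Vec.∷ʳ b ⇔ y ∈ₛ T
∈-∷ʳ-inject₁ (t ∷ T) b zero    = mk⇔ (λ { here → here }) (λ { here → here })
∈-∷ʳ-inject₁ (t ∷ T) b (suc y) = mk⇔ (λ { (there p) → there (to (∈-∷ʳ-inject₁ T b y) p) })
                                     (λ { (there p) → there (from (∈-∷ʳ-inject₁ T b y) p) })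

fromℕ∈∷ʳtrue : ∀ {n} (T : Subset n) → fromℕ n ∈ₛ T Vec.∷ʳ true
fromℕ∈∷ʳtrue []      = here
fromℕ∈∷ʳtrue (t ∷ T) = there (fromℕ∈∷ʳtrue T)

fromℕ∉∷ʳfalse : ∀ {n} (T : Subset n) → ¬ fromℕ n ∈ₛ T Vec.∷ʳ false
fromℕ∉∷ʳfalse (t ∷ T) (there p) = fromℕ∉∷ʳfalse T p

∣∷ʳfalse∣ : ∀ {n} (T : Subset n) → ∣ T Vec.∷ʳ false ∣ ≡ ∣ T ∣
∣∷ʳfalse∣ []          = refl
∣∷ʳfalse∣ (true ∷ T)  = cong suc (∣∷ʳfalse∣ T)
∣∷ʳfalse∣ (false ∷ T) = ∣∷ʳfalse∣ T

∣∷ʳtrue∣ : ∀ {n} (T : Subset n) → ∣ T Vec.∷ʳ true ∣ ≡ suc ∣ T ∣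
∣∷ʳtrue∣ []          = refl
∣∷ʳtrue∣ (true ∷ T)  = cong suc (∣∷ʳtrue∣ T)
∣∷ʳtrue∣ (false ∷ T) = ∣∷ʳtrue∣ T

facet-visited : ∀ m (S : Subset (suc m)) → Any (OnFacet S) (vertices m)
facet-visited zero    (false ∷ []) = here (from (prefix-zero (idWord 0)) λ { zero () })
facet-visited zero    (true ∷ [])  =
  here (from (prefix-full (idWord 0) ≤-refl λ { zero → zero , refl }) λ { zero → here })
facet-visited (suc m) S with initLast S
... | T , false , refl = subst (Any (OnFacet S)) (sym (vertices-suc m)) (Any.++⁺ˡ on-end)
  where
  end-on : ∀ a → OnFacet T a → OnFacet S (insertMax (fromℕ (suc m)) a)
  end-on a a-on = subst (λ k → Prefix (_∈ₛ S) k (insertMax (fromℕ (suc m)) a)) (sym (∣∷ʳfalse∣ T))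
    (from (prefix-insertMax-≥ (fromℕ (suc m)) a (_∈ₛ S) ∣ T ∣
                              (subst (∣ T ∣ ≤_) (sym (toℕ-fromℕ (suc m))) (∣p∣≤n T)))
      (fromℕ∉∷ʳfalse T , prefix-cong ∣ T ∣ a (λ y → ⇔.sym (∈-∷ʳ-inject₁ T false y)) a-on))
  on-end : Any (OnFacet S) (map (insertMax (fromℕ (suc m))) (vertices m))
  on-end = Any.map⁺ {f = insertMax (fromℕ (suc m))} {xs = vertices m}
    (Any.map (λ {a} → end-on a) (facet-visited m T))
... | T , true , refl = subst (Any (OnFacet S)) (sym (vertices-suc m))
  (Any.++⁺ʳ (map (insertMax (fromℕ (suc m))) (vertices m))
  (Any.++⁺ʳ (map (λ j → insertMax j (rotWord m)) (interior m)) on-front))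
  where
  front-on : ∀ a → OnFacet T a → OnFacet S (insertMax zero a)
  front-on a a-on = subst (λ k → Prefix (_∈ₛ S) k (insertMax zero a)) (sym (∣∷ʳtrue∣ T))
    (from (prefix-insertMax-< zero a (_∈ₛ S) ∣ T ∣ z≤n)
      (fromℕ∈∷ʳtrue T , prefix-cong ∣ T ∣ a (λ y → ⇔.sym (∈-∷ʳ-inject₁ T true y)) a-on))
  on-front : Any (OnFacet S) (map (insertMax zero) (reverse (vertices m)))
  on-front = Any.map⁺ {f = insertMax zero} {xs = reverse (vertices m)}
    (Any.map (λ {a} → front-on a) (Any.reverse⁺ (facet-visited m T)))

module _ {m} (convex-m : ∀ (Q : Fin (suc m) → Set) → Decidable Q → ∀ s → Convex (Prefix Q s) (vertices m))
         {P : Fin (suc (suc m)) → Set} (P? : Decidable P) {s} (s<1+m : s < suc m) where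

  private
    Φ     = Prefix P (suc s)
    Q     = P ∘ inject₁
    Q?    = P? ∘ inject₁
    n     = fromℕ (suc m)
    w     = rotWord m
    slide = λ j → insertMax j w
    end   = map (insertMax n) (vertices m)
    back  = map (insertMax zero) (reverseTail (idWord m) (route m))

    s<n : suc s ≤ toℕ n
    s<n = subst (suc s ≤_) (sym (toℕ-fromℕ (suc m))) s<1+m

    layout : ∀ hi lo → interior m ≡ hi ++ lo →
             vertices (suc m) ≡ end ++ map slide hi ++ map slide lo ++ insertMax zero w ∷ back
    layout hi lo interior≡ = begin
      vertices (suc m)
        ≡⟨ vertices-suc m ⟩
      end ++ map slide (interior m) ++ front
        ≡⟨ cong (λ js → end ++ map slide js ++ front) interior≡ ⟩
      end ++ map slide (hi ++ lo) ++ front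
        ≡⟨ cong (λ xs → end ++ xs ++ front) (map-++ slide hi lo) ⟩
      end ++ (map slide hi ++ map slide lo) ++ front
        ≡⟨ cong (end ++_) (++-assoc (map slide hi) (map slide lo) front) ⟩
      end ++ map slide hi ++ map slide lo ++ map (insertMax zero) (reverse (vertices m))
        ≡⟨ cong (λ xs → end ++ map slide hi ++ map slide lo ++ map (insertMax zero) xs) (reverse-vertices (walk m)) ⟩
      end ++ map slide hi ++ map slide lo ++ insertMax zero w ∷ back
        ∎
      where
      open ≡-Reasoning
      front = map (insertMax zero) (reverse (vertices m))

  convex-without-max : ¬ P n → Convex Φ (vertices (suc m))
  convex-without-max ¬Pn with interior-split m (suc s)
  ... | hi , lo , interior≡ , hi≥ , lo< =
    subst (Convex Φ) (sym (layout hi lo interior≡)) (glue (prefix? Q? (suc s) w) r-end)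
    where
    above : ∀ {j} a → suc s ≤ toℕ j → Φ (insertMax j a) ⇔ Prefix Q (suc s) a
    above {j} a s<j = ⇔.trans (prefix-insertMax-≥ j a P (suc s) s<j) (mk⇔ proj₂ (¬Pn ,_))
    below : ∀ {j} a → toℕ j < suc s → ¬ Φ (insertMax j a)
    below {j} a j≤s Φa = ¬Pn (proj₁ (to (prefix-insertMax-< j a P s (≤-pred j≤s)) Φa))
    r-end : ∃[ ψ ] Run Φ before end ψ
    r-end = let ψ , r = convex-m Q Q? (suc s) in ψ , run-map (insertMax n) (λ a → above a s<n) r
    walk-end : Walk Swapped (insertMax n (idWord m)) (insertMax n w) (map (insertMax n) (route m))
    walk-end = walk-map (insertMax n) Swapped-insertMax-fromℕ (walk m)
    rest-off : All (¬_ ∘ Φ) (map slide lo ++ insertMax zero w ∷ back)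
    rest-off = All.++⁺ (All.map⁺ (All.map (below w) lo<))
                       (All.map⁺ (All.universal (λ a → below a (s≤s z≤n)) _))
    glue : Dec (Prefix Q (suc s) w) → ∃[ ψ ] Run Φ before end ψ →
           Convex Φ (end ++ map slide hi ++ map slide lo ++ insertMax zero w ∷ back)
    glue (yes Qw) (ψ , r) with run-ends-inside walk-end r (from (above w s<n) Qw)
    ... | refl = let ψ′ , r′ = run-off rest-off inside in
                 ψ′ , r ++ʳ run-stay (All.map⁺ (All.map (λ s<j → from (above w s<j) Qw) hi≥)) ++ʳ r′
    glue (no ¬Qw) (ψ , r) =
      let hi-off = All.map⁺ (All.map (λ s<j → ¬Qw ∘ to (above w s<j)) hi≥)
          ψ′ , r′ = run-off (All.++⁺ hi-off rest-off) ψ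
      in ψ′ , r ++ʳ r′

  convex-with-max : P n → Convex Φ (vertices (suc m))
  convex-with-max Pn with interior-split m (suc s)
  ... | hi , lo , interior≡ , hi≥ , lo< =
    subst (Convex Φ) (sym (layout hi lo interior≡)) (glue (prefix? Q? s w) r-front)
    where
    above : ∀ {j} a → suc s ≤ toℕ j → ¬ Φ (insertMax j a)
    above {j} a s<j Φa = proj₁ (to (prefix-insertMax-≥ j a P (suc s) s<j) Φa) Pn
    below : ∀ {j} a → toℕ j < suc s → Φ (insertMax j a) ⇔ Prefix Q s a
    below {j} a j≤s = ⇔.trans (prefix-insertMax-< j a P s (≤-pred j≤s)) (mk⇔ proj₂ (Pn ,_))
    r-front : ∃[ ψ ] Run Φ before (insertMax zero w ∷ back) ψ
    r-front = let ψ , r = convex-reverse (convex-m Q Q? s) in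
      ψ , run-map (insertMax zero) (λ a → below a (s≤s z≤n))
                  (subst (λ xs → Run (Prefix Q s) before xs ψ) (reverse-vertices (walk m)) r)
    end-off : All (¬_ ∘ Φ) end
    end-off = All.map⁺ {f = insertMax n} (All.universal (λ a → above a s<n) (vertices m))
    hi-off : All (¬_ ∘ Φ) (map slide hi)
    hi-off = All.map⁺ (All.map (above w) hi≥)
    glue : Dec (Prefix Q s w) → ∃[ ψ ] Run Φ before (insertMax zero w ∷ back) ψ →
           Convex Φ (end ++ map slide hi ++ map slide lo ++ insertMax zero w ∷ back)
    glue (yes Qw) (ψ , r) = ψ , run-skip end-off ++ʳ run-skip hi-off ++ʳ
      prepend-block (All.map⁺ (All.map (λ j≤s → from (below w j≤s) Qw) lo<)) r (from (below w (s≤s z≤n)) Qw)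
    glue (no ¬Qw) (ψ , r) = ψ , run-skip end-off ++ʳ run-skip hi-off ++ʳ
      run-skip (All.map⁺ (All.map (λ j≤s → ¬Qw ∘ to (below w j≤s)) lo<)) ++ʳ r

vertices-convex : ∀ m (P : Fin (suc m) → Set) → Decidable P → ∀ s → Convex (Prefix P s) (vertices m)
vertices-convex m       P P? zero    = convex-const (all? (¬? ∘ P?)) (All.universal prefix-zero (vertices m))
vertices-convex m       P P? (suc s) with suc m ≤? suc s
... | yes full = convex-const (all? P?) (All.map (λ {π} → prefix-full π full) (vertices-onto m))
vertices-convex zero    P P? (suc s) | no short = ⊥-elim (short (s≤s z≤n))
vertices-convex (suc m) P P? (suc s) | no short with P? (fromℕ (suc m))
... | yes Pn = convex-with-max    (vertices-convex m) P? (≤-pred (≰⇒> short)) Pn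
... | no ¬Pn = convex-without-max (vertices-convex m) P? (≤-pred (≰⇒> short)) ¬Pn

lemma2p1 : ∀ (m : ℕ) →
    Σ[ k ∈ ℕ ] Σ[ p ∈ (Fin (suc k) → Word (suc m)) ]
      (IsPath p × p zero ≡ idWord m × p (fromℕ k) ≡ rotWord m × FacetHamiltonian p)
lemma2p1 m = length (route m) , lookup (vertices m) , path , refl , lookup-last (walk m) , facet-hamiltonian
  where
  path : IsPath (lookup (vertices m))
  path = record
    { perms    = λ i → All.lookup (vertices-perm m) (∈-lookup i)
    ; distinct = Unique-lookup-injective (vertices-unique m)
    ; steps    = λ i → Swapped-transposition (lookup-steps (walk m) i)
    }
  -- Both properties hold for every subset.
  facet-hamiltonian : FacetHamiltonian (lookup (vertices m))
  facet-hamiltonian S _ =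
    let on-S = facet-visited m S in
    (Any.index on-S , Any.lookup-index on-S) ,
    interval-connected (run-interval (proj₂ (vertices-convex m (_∈ₛ S) (_∈? S) ∣ S ∣)))
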